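{- Let $\pi\in\mathrm{FFT}$, and consider the coalgebra $(\mathrm{FFT},\mathrm{destruct})$. (i) If $r\in\mathrm{Roots}(\mathrm{destruct},\pi)$, then (a) $\mathrm{word}(r)\in\mathrm{roots}(\pi)$, (b) $\mathrm{rp}(\pi,\mathrm{word}(r))=r$, (c) $\mathrm{frag}^{\mathrm{destruct}}(\pi,r)=\mathrm{tf}(\pi,\mathrm{word}(r))$, (d) $\mathrm{sub}^{\mathrm{destruct}}(\pi,r)=\mathrm{st}(\pi,\mathrm{word}(r))$. (ii) If $w\in\mathrm{roots}(\pi)$, then (a) $\mathrm{rp}(\pi,w)\in\mathrm{Roots}(\mathrm{destruct},\pi)$, (b) $\mathrm{word}(\mathrm{rp}(\pi,w))=w$, (c) $\mathrm{tf}(\pi,w)=\mathrm{frag}^{\mathrm{destruct}}(\pi,\mathrm{rp}(\pi,w))$, (d) $\mathrm{st}(\pi,w)=\mathrm{sub}^{\mathrm{destruct}}(\pi,\mathrm{rp}(\pi,w))$.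
   Context: Words are finite sequences of natural numbers; $\mathbb{N}^*$ the set of words, $\epsilon$ the empty word, $\mathbb{N}^+$ the nonempty words; concatenation is juxtaposition; $\sqsubseteq$ the prefix order ($\sqsubset$ strict). Finite sequences of elements of $\mathbb{N}^+$ are denoted $r,s$; $\mathsf{nil}$ is the empty sequence, $w{:}r$ prepends $w$, $[w_1,\dots,w_n]$ denotes a sequence. A tree is a prefix-closed set of words (nodes) with a labelling $\ell$; trees are finitely branching. Fix a set $A$ of labels and $*\notin A$. A finite tree with non-wellfounded leaves is a finite tree $\iota$ labelled in $A\cup\{*\}$ whose root is not labelled $*$ and whose $*$-labelled nodes are leaves; $\mathrm{nwleaf}(\iota)$ is its set of $*$-labelled nodes; $\mathrm{NWT}$ the set of these. $\mathcal{T}(X)=\{(\iota,\mu):\iota\in\mathrm{NWT},\ \mu:\mathrm{nwleaf}(\iota)\to X\}$. For a map $\alpha:C\to\mathcal{T}(C)$ write $\alpha(c)=(\iota^\alpha_c,\mu^\alpha_c)$. Root-paths: $\mathsf{nil}\in\mathrm{Roots}(\alpha,c)$; $w{:}r\in\mathrm{Roots}(\alpha,c)$ iff $w\in\mathrm{nwleaf}(\iota^\alpha_c)$ and $r\in\mathrm{Roots}(\alpha,\mu^\alpha_c(w))$. Subelement: $\mathrm{sub}^\alpha(c,\mathsf{nil})=c$, $\mathrm{sub}^\alpha(c,w{:}r)=\mathrm{sub}^\alpha(\mu^\alpha_c(w),r)$; fragment: $\mathrm{frag}^\alpha(c,\mathsf{nil})=\iota^\alpha_c$, $\mathrm{frag}^\alpha(c,w{:}r)=\mathrm{frag}^\alpha(\mu^\alpha_c(w),r)$;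 $\mathrm{word}(\mathsf{nil})=\epsilon$, $\mathrm{word}(w{:}r)=w\,\mathrm{word}(r)$. A set $F\subseteq\mathbb{N}^*$ has the fragmentation properties if finite, with a $\sqsubseteq$-minimum, and convex. A finite-fragmented tree is $\pi=(\tau,\mathcal{F})$ with $\tau$ a (possibly infinite) tree labelled in $A$ and $\mathcal{F}$ a partition of its nodes into sets with the fragmentation properties; $\sim^\pi$ the equivalence; $\mathrm{FFT}$ the set of these; $\mathrm{roots}(\pi)$ the minima of blocks. For roots, $w\lhd v$ iff $w\sqsubset v$ and no root $u$ has $w\sqsubset u\sqsubset v$. $\mathrm{tf}(\pi,w)$ (for a root $w$) has nodes $\{v: w\sim^\pi wv\}\cup\{u\in\mathbb{N}^+: w\lhd wu\}$, labelled $\ell^\pi(wv)$ resp. $*$; $\mathrm{st}(\pi,w)$ has nodes $\{v: wv\text{ node of }\pi\}$, labels $v\mapsto\ell^\pi(wv)$, $v\sim u$ iff $wv\sim^\pi wu$. $\mathrm{destruct}(\pi)=(\mathrm{tf}(\pi,\epsilon),\ w\mapsto\mathrm{st}(\pi,w))$. For $w\in\mathrm{roots}(\pi)$ there is a unique sequence of roots $\epsilon=w_0\lhd w_1\lhd\dots\lhd w_n=w$; define $\mathrm{rp}(\pi,w)=[w_1-w_0,w_2-w_1,\dots,w_n-w_{n-1}]$ where $w_{i+1}-w_i$ is the word $u$ with $w_iu=w_{i+1}$ (so $\mathrm{rp}(\pi,\epsilon)=\mathsf{nil}$). -}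

module Defs where

open import Data.Nat using (ℕ; _<_)
open import Data.List using (List; []; _∷_; _++_)
open import Data.List.Membership.Propositional using (_∈_)
open import Data.Maybe using (Maybe; just; nothing)
open import Data.Product using (Σ; ∃; ∃-syntax; _×_; _,_; proj₁; proj₂)
open import Data.Sum using (_⊎_; inj₁; inj₂)
open import Data.Empty using (⊥)
open import Relation.Nullary using (¬_)
open import Relation.Binary.PropositionalEquality using (_≡_; _≢_)

Word : Set
Word = List ℕ

_⊑_ : Word → Word → Set
u ⊑ v = ∃[ x ] (u ++ x ≡ v)

_⊏_ : Word → Word → Set
u ⊏ v = (u ⊑ v) × (u ≢ v)

infix 4 _⊑_ _⊏_

_⇔′_ : Set → Set → Set
P ⇔′ Q = (P → Q) × (Q → P)

FiniteSet : (Word → Set) → Set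
FiniteSet B = ∃[ xs ] (∀ v → B v ⇔′ (v ∈ xs))

record RawTree (L : Set) : Set₁ where
  field
    node  : Word → Set
    label : (w : Word) → node w → L
open RawTree public

record IsTree {L : Set} (t : RawTree L) : Set where
  field
    root-node   : node t []
    prefix-cl   : ∀ u v → node t (u ++ v) → node t u
    fin-branch  : ∀ w → node t w → ∃[ n ] (∀ i → node t (w ++ (i ∷ [])) → i < n)
    label-irr   : ∀ w (p q : node t w) → label t w p ≡ label t w q

_≅T_ : {L : Set} → RawTree L → RawTree L → Set
s ≅T t = (∀ v → node s v ⇔′ node t v)
       × (∀ v (p : node s v) (q : node t v) → label s v p ≡ label t v q)

-- Finite trees with non-wellfounded leaves; labels in A ∪ {*},
-- encoded as Maybe A with  nothing = *.

NWRaw : Set → Set₁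
NWRaw A = RawTree (Maybe A)

record IsNWT {A : Set} (ι : NWRaw A) : Set where
  field
    tree       : IsTree ι
    finite     : FiniteSet (node ι)
    root-not-* : ∀ (p : node ι []) → label ι [] p ≢ nothing
    *-leaf     : ∀ w (p : node ι w) → label ι w p ≡ nothing →
                 ∀ v → node ι (w ++ v) → v ≡ []

nwleaf : {A : Set} → NWRaw A → Word → Set
nwleaf ι w = Σ (node ι w) (λ p → label ι w p ≡ nothing)

record 𝒯 (A : Set) (X : Set₁) : Set₁ where
  constructor ⟨_,_⟩
  field
    ι : NWRaw A
    μ : (w : Word) → nwleaf ι w → X
open 𝒯 public

module Coalg {A : Set} {C : Set₁} (α : C → 𝒯 A C) where

  data Roots : C → List Word → Set₁ where
    nil  : ∀ {c} → Roots c []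
    cons : ∀ {c w r} (p : nwleaf (ι (α c)) w) →
           Roots (μ (α c) w p) r → Roots c (w ∷ r)

  sub : ∀ {c r} → Roots c r → C
  sub {c} nil = c
  sub (cons p R) = sub R

  frag : ∀ {c r} → Roots c r → NWRaw A
  frag {c} nil = ι (α c)
  frag (cons p R) = frag R

word : List Word → Word
word [] = []
word (w ∷ r) = w ++ word r

-- Finite-fragmented trees.  The partition 𝓕 is given by its
-- equivalence relation ∼ (blocks = equivalence classes).

record RawFFT (A : Set) : Set₁ where
  field
    tree : RawTree A
    _∼_  : Word → Word → Set
open RawFFT public

record FragProps (B : Word → Set) : Set where
  field
    finite  : FiniteSet B
    minimum : ∃[ m ] (B m × (∀ v → B v → m ⊑ v))
    convex  : ∀ u v x → B u → B x → u ⊑ v → v ⊑ x → B v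

record IsFFT {A : Set} (π : RawFFT A) : Set where
  field
    isTree    : IsTree (tree π)
    rel-nodes : ∀ u v → _∼_ π u v → node (tree π) u × node (tree π) v
    refl∼     : ∀ u → node (tree π) u → _∼_ π u u
    sym∼      : ∀ u v → _∼_ π u v → _∼_ π v u
    trans∼    : ∀ u v x → _∼_ π u v → _∼_ π v x → _∼_ π u x
    blocks    : ∀ u → node (tree π) u → FragProps (λ v → _∼_ π u v)

_≅F_ : {A : Set} → RawFFT A → RawFFT A → Set
π ≅F ρ = (tree π ≅T tree ρ) × (∀ u v → _∼_ π u v ⇔′ _∼_ ρ u v)

module _ {A : Set} (π : RawFFT A) where

  IsRoot : Word → Set
  IsRoot w = node (tree π) w × (∀ v → _∼_ π v w → w ⊑ v)

  _◁_ : Word → Word → Set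
  w ◁ v = IsRoot w × IsRoot v × w ⊏ v
        × (∀ u → IsRoot u → w ⊏ u → u ⊏ v → ⊥)

  tf : Word → NWRaw A
  node (tf w) v = (node (tree π) (w ++ v) × _∼_ π w (w ++ v))
                ⊎ ((v ≢ []) × (w ◁ (w ++ v)))
  label (tf w) v (inj₁ (p , _)) = just (label (tree π) (w ++ v) p)
  label (tf w) v (inj₂ _) = nothing

  st : Word → RawFFT A
  node (tree (st w)) v = node (tree π) (w ++ v)
  label (tree (st w)) v p = label (tree π) (w ++ v) p
  _∼_ (st w) v u = _∼_ π (w ++ v) (w ++ u)

  -- RPfrom p w r : r = [w₁ - w₀ , … , wₙ - wₙ₋₁] for a chain of roots
  -- p = w₀ ◁ w₁ ◁ … ◁ wₙ = w.
  data RPfrom : Word → Word → List Word → Set where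
    done : ∀ {p} → RPfrom p p []
    step : ∀ {p w u r} → p ◁ (p ++ u) → RPfrom (p ++ u) w r →
           RPfrom p w (u ∷ r)

  -- rp(π , w) = r  (as a relation; the chain ε = w₀ ◁ … ◁ wₙ = w is unique)
  RP : Word → List Word → Set
  RP w r = RPfrom [] w r

destruct : {A : Set} → RawFFT A → 𝒯 A (RawFFT A)
destruct π = ⟨ tf π [] , (λ w _ → st π w) ⟩

{-# OPTIONS --safe #-}
-- Along a root-path r from a root w, the subelement reached is (up to ≅F) st(π, w).
-- The key fact is that the ∼-block of any node above a root w stays above w: its
-- minimum is comparable with w, and if it lay below w, convexity would put w into
-- the block.  Hence the roots of st(π, w) are the roots of π above w, the
-- non-wellfounded leaves of tf(st(π, w), ε) are the v with w ◁ wv, and one destruct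
-- step along v is one ◁-step from w to wv; both directions then go by induction on
-- the path.  For the existence of rp(π, w), the shortest nonempty extension of a
-- root p towards w that is again a root is a ◁-successor of p; rootness of a node
-- is decidable because blocks are finite.
module Submission where

open import Defs
open import Data.List using (List; []; _∷_; _++_; length)
open import Data.List.Properties using (++-assoc; ++-identityʳ; ++-cancelˡ; ++-conicalˡ; ∷-injective; length-++)
open import Data.List.Relation.Binary.Pointwise using (Pointwise-≡⇒≡; ≡⇒Pointwise-≡)
open import Data.List.Relation.Binary.Prefix.Heterogeneous as Prefix using (Prefix; toView; fromView)
open import Data.List.Relation.Binary.Prefix.Heterogeneous.Properties using (prefix?)
open import Data.List.Relation.Unary.All as All using (all?)
open import Data.Nat using (_<_; _≤_; s≤s; _≟_)
open import Data.Nat.Properties using (m≤n+m)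
open import Data.Nat.Induction using (<-wellFounded)
open import Induction.WellFounded using (Acc; acc)
open import Data.Product using (Σ; ∃-syntax; _×_; _,_; proj₁; proj₂; swap)
open import Data.Sum using (_⊎_; inj₁; inj₂)
open import Data.Maybe using (just)
open import Data.Empty using (⊥; ⊥-elim)
open import Function using (_∘_; id)
open import Relation.Nullary using (¬_; Dec; yes; no)
open import Relation.Nullary.Decidable using (map′)
open import Relation.Binary.PropositionalEquality using (_≡_; _≢_; refl; sym; trans; cong; subst; subst₂)

private
  variable
    A : Set
    p q u v w x y : Word
    r : List Word
    ρ σ : RawFFT A

⊑-trans : u ⊑ v → v ⊑ w → u ⊑ w
⊑-trans {u} (x , refl) (y , refl) = x ++ y , sym (++-assoc u x y)

⊑-antisym : u ⊑ v → v ⊑ u → u ≡ v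
⊑-antisym {u} (x , refl) (y , e)
  with ++-conicalˡ x y (++-cancelˡ u (x ++ y) []
         (trans (sym (++-assoc u x y)) (trans e (sym (++-identityʳ u)))))
... | refl = sym (++-identityʳ u)

⊏⇒⋣ : u ⊏ v → ¬ (v ⊑ u)
⊏⇒⋣ (u⊑v , u≢v) v⊑u = u≢v (⊑-antisym u⊑v v⊑u)

¬⊏[] : ¬ (u ⊏ [])
¬⊏[] {u} ((x , e) , u≢[]) = u≢[] (++-conicalˡ u x e)

prefixes-comparable : u ⊑ w → v ⊑ w → u ⊑ v ⊎ v ⊑ u
prefixes-comparable {u = []} _ _ = inj₁ (_ , refl)
prefixes-comparable {u = _ ∷ _} {v = []} _ _ = inj₂ (_ , refl)
prefixes-comparable {u = a ∷ u} {v = b ∷ v} (s , refl) (t , e) with ∷-injective e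
... | refl , e′ with prefixes-comparable {u = u} (s , refl) (t , e′)
... | inj₁ (x , e″) = inj₁ (x , cong (a ∷_) e″)
... | inj₂ (x , e″) = inj₂ (x , cong (a ∷_) e″)

++⁺-⊑ : ∀ w → u ⊑ v → w ++ u ⊑ w ++ v
++⁺-⊑ {u} w (x , refl) = x , ++-assoc w u x

++⁻-⊑ : ∀ w → w ++ u ⊑ w ++ v → u ⊑ v
++⁻-⊑ {u} w (x , e) = x , ++-cancelˡ w _ _ (trans (sym (++-assoc w u x)) e)

++⁺-⊏ : ∀ w → u ⊏ v → w ++ u ⊏ w ++ v
++⁺-⊏ w (u⊑v , u≢v) = ++⁺-⊑ w u⊑v , u≢v ∘ ++-cancelˡ w _ _

++⁻-⊏ : ∀ w → w ++ u ⊏ w ++ v → u ⊏ v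
++⁻-⊏ w (wu⊑wv , wu≢wv) = ++⁻-⊑ w wu⊑wv , wu≢wv ∘ cong (w ++_)

⊏-++⁺ : ∀ w → v ≢ [] → w ⊏ w ++ v
⊏-++⁺ w v≢[] = (_ , refl) , λ e → v≢[] (sym (++-cancelˡ w [] _ (trans (++-identityʳ w) e)))

⊏-++⁻ : ∀ w → w ⊏ w ++ v → v ≢ []
⊏-++⁻ w (_ , w≢w++v) refl = w≢w++v (sym (++-identityʳ w))

Prefix⇒⊑ : Prefix _≡_ u v → u ⊑ v
Prefix⇒⊑ u≼v with toView u≼v
... | u≋ Prefix.++ x = x , cong (_++ x) (Pointwise-≡⇒≡ u≋)

⊑⇒Prefix : u ⊑ v → Prefix _≡_ u v
⊑⇒Prefix (x , refl) = fromView (≡⇒Pointwise-≡ refl Prefix.++ x)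

_⊑?_ : ∀ u v → Dec (u ⊑ v)
u ⊑? v = map′ Prefix⇒⊑ ⊑⇒Prefix (prefix? _≟_ u v)

length<length-++ : u ≢ [] → length v < length (u ++ v)
length<length-++ {u = []} u≢[] = ⊥-elim (u≢[] refl)
length<length-++ {u = _ ∷ u} {v} _ =
  s≤s (subst (length v ≤_) (sym (length-++ u)) (m≤n+m (length v) (length u)))

least-prefix : (P : Word → Set) → (∀ u → u ⊑ x → Dec (P u)) → P x →
               ∃[ u ] (u ⊑ x × P u × (∀ v → v ⊏ u → ¬ P v))
least-prefix P P? Px with P? [] (_ , refl)
... | yes P[] = [] , (_ , refl) , P[] , λ _ v⊏[] _ → ¬⊏[] v⊏[]
least-prefix {x = []} P P? Px | no ¬P[] = ⊥-elim (¬P[] Px)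
least-prefix {x = a ∷ x} P P? Px | no ¬P[]
  with least-prefix (P ∘ (a ∷_)) (λ u u⊑x → P? (a ∷ u) (++⁺-⊑ (a ∷ []) u⊑x)) Px
... | u , u⊑x , Pau , minimal = a ∷ u , ++⁺-⊑ (a ∷ []) u⊑x , Pau , minimal′
  where
  minimal′ : ∀ v → v ⊏ a ∷ u → ¬ P v
  minimal′ [] _ = ¬P[]
  minimal′ (b ∷ v) bv⊏au with ∷-injective (proj₂ (proj₁ bv⊏au))
  ... | refl , _ = minimal v (++⁻-⊏ (a ∷ []) bv⊏au)

⇔′-trans : {P Q R : Set} → P ⇔′ Q → Q ⇔′ R → P ⇔′ R
⇔′-trans (f , g) (h , k) = h ∘ f , g ∘ k

≅T-sym : {L : Set} {s t : RawTree L} → s ≅T t → t ≅T s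
≅T-sym (nodes , labels) = (swap ∘ nodes) , λ v p q → sym (labels v q p)

≅T-trans : {L : Set} {s t t′ : RawTree L} → s ≅T t → t ≅T t′ → s ≅T t′
≅T-trans (nodes₁ , labels₁) (nodes₂ , labels₂) =
  (λ v → ⇔′-trans (nodes₁ v) (nodes₂ v)) ,
  λ v p q → trans (labels₁ v p (proj₁ (nodes₁ v) p)) (labels₂ v _ q)

≅F-sym : ρ ≅F σ → σ ≅F ρ
≅F-sym (trees , rel) = ≅T-sym trees , λ u v → swap (rel u v)

≅F-trans : {τ : RawFFT A} → ρ ≅F σ → σ ≅F τ → ρ ≅F τ
≅F-trans (trees₁ , rel₁) (trees₂ , rel₂) =
  ≅T-trans trees₁ trees₂ , λ u v → ⇔′-trans (rel₁ u v) (rel₂ u v)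

IsRoot-resp-≅F : ρ ≅F σ → IsRoot ρ w → IsRoot σ w
IsRoot-resp-≅F {w = w} ((nodes , _) , rel) (node-w , least) =
  proj₁ (nodes w) node-w , λ v v∼w → least v (proj₂ (rel v w) v∼w)

◁-resp-≅F : ρ ≅F σ → _◁_ ρ u v → _◁_ σ u v
◁-resp-≅F ρ≅σ (u-root , v-root , u⊏v , between) =
  IsRoot-resp-≅F ρ≅σ u-root , IsRoot-resp-≅F ρ≅σ v-root , u⊏v ,
  λ x x-root → between x (IsRoot-resp-≅F (≅F-sym ρ≅σ) x-root)

◁⇒≁ : _◁_ ρ u v → ¬ (_∼_ ρ u v)
◁⇒≁ (_ , (_ , v-least) , u⊏v , _) u∼v = ⊏⇒⋣ u⊏v (v-least _ u∼v)

tf-node-resp-≅F : ρ ≅F σ → node (tf ρ w) v → node (tf σ w) v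
tf-node-resp-≅F {w = w} {v} ((nodes , _) , rel) (inj₁ (node-wv , w∼wv)) =
  inj₁ (proj₁ (nodes (w ++ v)) node-wv , proj₁ (rel w (w ++ v)) w∼wv)
tf-node-resp-≅F ρ≅σ (inj₂ (v≢[] , w◁wv)) = inj₂ (v≢[] , ◁-resp-≅F ρ≅σ w◁wv)

tf-resp-≅F : ρ ≅F σ → tf ρ w ≅T tf σ w
tf-resp-≅F {ρ = ρ} {σ} {w} ρ≅σ@((_ , labels) , rel) =
  (λ v → tf-node-resp-≅F ρ≅σ , tf-node-resp-≅F (≅F-sym ρ≅σ)) , tf-labels
  where
  tf-labels : ∀ v p q → label (tf ρ w) v p ≡ label (tf σ w) v q
  tf-labels v (inj₁ (node-wv , _)) (inj₁ (node-wv′ , _)) =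
    cong just (labels (w ++ v) node-wv node-wv′)
  tf-labels v (inj₁ (_ , w∼wv)) (inj₂ (_ , w◁wv)) =
    ⊥-elim (◁⇒≁ {ρ = σ} w◁wv (proj₁ (rel w (w ++ v)) w∼wv))
  tf-labels v (inj₂ (_ , w◁wv)) (inj₁ (_ , w∼wv)) =
    ⊥-elim (◁⇒≁ {ρ = ρ} w◁wv (proj₂ (rel w (w ++ v)) w∼wv))
  tf-labels v (inj₂ _) (inj₂ _) = refl

st-resp-≅F : ρ ≅F σ → st ρ u ≅F st σ u
st-resp-≅F {u = u} ((nodes , labels) , rel) =
  ((λ v → nodes (u ++ v)) , (λ v → labels (u ++ v))) , λ x y → rel (u ++ x) (u ++ y)

st-[] : IsTree (tree ρ) → ρ ≅F st ρ []
st-[] ρ-tree = ((λ _ → id , id) , IsTree.label-irr ρ-tree) , λ _ _ → id , id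

st-st : IsTree (tree ρ) → st (st ρ w) u ≅F st ρ (w ++ u)
st-st {ρ = ρ} {w} {u} ρ-tree =
  ((λ v → subst N (sym (assoc v)) , subst N (assoc v)) , (λ v → label-cong (sym (assoc v)))) ,
  λ x y → subst₂ (_∼_ ρ) (sym (assoc x)) (sym (assoc y)) , subst₂ (_∼_ ρ) (assoc x) (assoc y)
  where
  N : Word → Set
  N = node (tree ρ)
  assoc : ∀ v → (w ++ u) ++ v ≡ w ++ (u ++ v)
  assoc = ++-assoc w u
  label-cong : (e : x ≡ y) (p : N x) (q : N y) → label (tree ρ) x p ≡ label (tree ρ) y q
  label-cong refl = IsTree.label-irr ρ-tree _

module RootPaths {A : Set} (π : RawFFT A) (π-FFT : IsFFT π) where
  open IsFFT π-FFT
  open Coalg {A} {RawFFT A} destruct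

  private
    N : Word → Set
    N = node (tree π)

    _∼π_ : Word → Word → Set
    _∼π_ = _∼_ π

  IsRoot-[] : IsRoot π []
  IsRoot-[] = IsTree.root-node isTree , λ v _ → v , refl

  ∼-closed-above-root : IsRoot π w → x ∼π (w ++ y) → w ⊑ x
  ∼-closed-above-root {w} {x} {y} (_ , w-least) x∼wy
    with rel-nodes x (w ++ y) x∼wy
  ... | _ , node-wy with FragProps.minimum (blocks (w ++ y) node-wy)
  ... | m , wy∼m , m-least
    with prefixes-comparable (y , refl) (m-least (w ++ y) (refl∼ _ node-wy))
  ... | inj₁ w⊑m = ⊑-trans w⊑m (m-least x (sym∼ _ _ x∼wy))
  ... | inj₂ m⊑w = w-least x (trans∼ _ _ _ x∼wy wy∼w)
    where
    wy∼w : (w ++ y) ∼π w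
    wy∼w = FragProps.convex (blocks (w ++ y) node-wy) m w (w ++ y)
             wy∼m (refl∼ _ node-wy) m⊑w (y , refl)

  IsRoot-st⁺ : IsRoot π w → IsRoot (st π w) u → IsRoot π (w ++ u)
  IsRoot-st⁺ {w} {u} w-root (node-wu , u-least) = node-wu , wu-least
    where
    wu-least : ∀ x → x ∼π (w ++ u) → w ++ u ⊑ x
    wu-least x x∼wu with ∼-closed-above-root w-root x∼wu
    ... | y , refl = ++⁺-⊑ w (u-least y x∼wu)

  IsRoot-st⁻ : IsRoot π (w ++ u) → IsRoot (st π w) u
  IsRoot-st⁻ {w} (node-wu , wu-least) = node-wu , λ y wy∼wu → ++⁻-⊑ w (wu-least (w ++ y) wy∼wu)

  IsRoot-st-[] : IsRoot π w → IsRoot (st π w) []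
  IsRoot-st-[] {w} w-root = IsRoot-st⁻ (subst (IsRoot π) (sym (++-identityʳ w)) w-root)

  ◁-st⁺ : IsRoot π w → _◁_ (st π w) [] v → _◁_ π w (w ++ v)
  ◁-st⁺ {w} {v} w-root (_ , v-root , []⊏v , between) =
    w-root , IsRoot-st⁺ w-root v-root , ⊏-++⁺ w (⊏-++⁻ [] []⊏v) , between′
    where
    between′ : ∀ x → IsRoot π x → w ⊏ x → x ⊏ w ++ v → ⊥
    between′ x x-root w⊏x x⊏wv with proj₁ w⊏x
    ... | y , refl = between y (IsRoot-st⁻ x-root) (⊏-++⁺ [] (⊏-++⁻ w w⊏x)) (++⁻-⊏ w x⊏wv)

  ◁-st⁻ : _◁_ π w (w ++ v) → _◁_ (st π w) [] v
  ◁-st⁻ {w} (w-root , wv-root , w⊏wv , between) =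
    IsRoot-st-[] w-root , IsRoot-st⁻ wv-root , ⊏-++⁺ [] (⊏-++⁻ w w⊏wv) ,
    λ y y-root []⊏y y⊏v →
      between (w ++ y) (IsRoot-st⁺ w-root y-root) (⊏-++⁺ w (⊏-++⁻ [] []⊏y)) (++⁺-⊏ w y⊏v)

  tf-st : IsRoot π w → tf (st π w) [] ≅T tf π w
  tf-st {w} w-root = (λ v → to v , from v) , tf-labels
    where
    w[]≡w : w ++ [] ≡ w
    w[]≡w = ++-identityʳ w
    to : ∀ v → node (tf (st π w) []) v → node (tf π w) v
    to v (inj₁ (node-wv , w[]∼wv)) = inj₁ (node-wv , subst (_∼π (w ++ v)) w[]≡w w[]∼wv)
    to v (inj₂ (v≢[] , []◁v)) = inj₂ (v≢[] , ◁-st⁺ w-root []◁v)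
    from : ∀ v → node (tf π w) v → node (tf (st π w) []) v
    from v (inj₁ (node-wv , w∼wv)) = inj₁ (node-wv , subst (_∼π (w ++ v)) (sym w[]≡w) w∼wv)
    from v (inj₂ (v≢[] , w◁wv)) = inj₂ (v≢[] , ◁-st⁻ w◁wv)
    tf-labels : ∀ v p q → label (tf (st π w) []) v p ≡ label (tf π w) v q
    tf-labels v (inj₁ (node-wv , _)) (inj₁ (node-wv′ , _)) =
      cong just (IsTree.label-irr isTree (w ++ v) node-wv node-wv′)
    tf-labels v (inj₁ (_ , w[]∼wv)) (inj₂ (_ , w◁wv)) =
      ⊥-elim (◁⇒≁ {ρ = π} w◁wv (subst (_∼π (w ++ v)) w[]≡w w[]∼wv))
    tf-labels v (inj₂ (_ , []◁v)) (inj₁ (_ , w∼wv)) =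
      ⊥-elim (◁⇒≁ {ρ = π} (◁-st⁺ w-root []◁v) w∼wv)
    tf-labels v (inj₂ _) (inj₂ _) = refl

  st-shift : {c : RawFFT A} → c ≅F st π w → st c u ≅F st π (w ++ u)
  st-shift {w} {u} c≅ = ≅F-trans (st-resp-≅F c≅) (st-st {ρ = π} {w} {u} isTree)

  Reaches : {c : RawFFT A} → Roots c r → Word → Word → Set
  Reaches {r = r} R w q =
    IsRoot π q × RPfrom π w q r × (frag R ≅T tf π q) × (sub R ≅F st π q)

  Roots⇒RP : {c : RawFFT A} → IsRoot π w → c ≅F st π w → (R : Roots c r) →
             Reaches R w (w ++ word r)
  Roots⇒RP {w} w-root c≅ nil =
    subst (Reaches nil w) (sym (++-identityʳ w))
      (w-root , done , ≅T-trans (tf-resp-≅F c≅) (tf-st w-root) , c≅)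
  Roots⇒RP w-root c≅ (cons (inj₁ _ , ()) _)
  Roots⇒RP {w} w-root c≅ R′@(cons {w = u} {r = r} (inj₂ (_ , []◁u) , refl) R) =
    let w◁wu = ◁-st⁺ w-root (◁-resp-≅F c≅ []◁u)
        q-root , rp , frag≅ , sub≅ = Roots⇒RP (proj₁ (proj₂ w◁wu)) (st-shift c≅) R
    in subst (Reaches R′ w) (++-assoc w u (word r)) (q-root , step w◁wu rp , frag≅ , sub≅)

  RP⇒Roots : {c : RawFFT A} → c ≅F st π w → RPfrom π w q r →
             Σ (Roots c r) (λ _ → w ++ word r ≡ q)
  RP⇒Roots {w} _ done = nil , ++-identityʳ w
  RP⇒Roots {w} c≅ (step {u = u} {r = r} w◁wu rest) =
    let R , e = RP⇒Roots (st-shift c≅) rest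
        []◁u = ◁-resp-≅F (≅F-sym c≅) (◁-st⁻ w◁wu)
        u≢[] = ⊏-++⁻ w (proj₁ (proj₂ (proj₂ w◁wu)))
    in cons (inj₂ (u≢[] , []◁u) , refl) R , trans (sym (++-assoc w u (word r))) e

  IsRoot? : ∀ q → N q → Dec (IsRoot π q)
  IsRoot? q node-q with FragProps.finite (blocks q node-q)
  ... | block , block-iff with all? (q ⊑?_) block
  ... | yes all⊒q =
    yes (node-q , λ v v∼q → All.lookup all⊒q (proj₁ (block-iff v) (sym∼ v q v∼q)))
  ... | no ¬all⊒q = no λ (_ , q-least) →
    ¬all⊒q (All.tabulate λ {v} v∈block → q-least v (sym∼ q v (proj₂ (block-iff v) v∈block)))

  IsRootAbove : Word → Word → Set
  IsRootAbove p u = u ≢ [] × IsRoot π (p ++ u)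

  IsRootAbove? : N q → ∀ p u → p ++ u ⊑ q → Dec (IsRootAbove p u)
  IsRootAbove? _ p [] _ = no λ ([]≢[] , _) → []≢[] refl
  IsRootAbove? node-q p u@(_ ∷ _) (x , refl) =
    map′ ((λ ()) ,_) proj₂ (IsRoot? (p ++ u) (IsTree.prefix-cl isTree (p ++ u) x node-q))

  least-root-above⇒◁ : IsRoot π p → IsRootAbove p u → (∀ v → v ⊏ u → ¬ IsRootAbove p v) →
                       _◁_ π p (p ++ u)
  least-root-above⇒◁ {p} {u} p-root (u≢[] , pu-root) minimal =
    p-root , pu-root , ⊏-++⁺ p u≢[] , between
    where
    between : ∀ q → IsRoot π q → p ⊏ q → q ⊏ p ++ u → ⊥
    between q q-root p⊏q q⊏pu with proj₁ p⊏q
    ... | v , refl = minimal v (++⁻-⊏ p q⊏pu) (⊏-++⁻ p p⊏q , q-root)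

  RPfrom-exists : IsRoot π p → IsRoot π q → ∀ x → p ++ x ≡ q → Acc _<_ (length x) →
                  ∃[ r ] RPfrom π p q r
  RPfrom-exists {p} _ _ [] e _ with trans (sym (++-identityʳ p)) e
  ... | refl = [] , done
  RPfrom-exists {p} p-root q-root x@(_ ∷ _) refl (acc shorter) =
    let above? u u⊑x = IsRootAbove? (proj₁ q-root) p u (++⁺-⊑ p u⊑x)
        u , (z , u++z≡x) , u-above , minimal = least-prefix (IsRootAbove p) above? ((λ ()) , q-root)
        p◁pu = least-root-above⇒◁ p-root u-above minimal
        z<x = subst (λ y → length z < length y) u++z≡x (length<length-++ (proj₁ u-above))
        pu++z≡q = trans (++-assoc p u z) (cong (p ++_) u++z≡x)
        r , rp = RPfrom-exists (proj₁ (proj₂ p◁pu)) q-root z pu++z≡q (shorter z<x)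
    in u ∷ r , step p◁pu rp

  RP-exists : IsRoot π w → ∃[ r ] RP π w r
  RP-exists {w} w-root = RPfrom-exists IsRoot-[] w-root w refl (<-wellFounded (length w))

  RP⇒Roots-[] : RP π w r →
                Σ (Roots π r) (λ R → word r ≡ w × (tf π w ≅T frag R) × (st π w ≅F sub R))
  RP⇒Roots-[] rp with RP⇒Roots (st-[] isTree) rp
  ... | R , refl with Roots⇒RP IsRoot-[] (st-[] isTree) R
  ... | _ , _ , frag≅ , sub≅ = R , refl , ≅T-sym frag≅ , ≅F-sym sub≅

lemma2p16 : {A : Set} (π : RawFFT A) → IsFFT π →
    ((r : List Word) (R : Coalg.Roots destruct π r) →
        IsRoot π (word r)
      × RP π (word r) r
      × (Coalg.frag destruct R ≅T tf π (word r))
      × (Coalg.sub destruct R ≅F st π (word r)))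
  × ((w : Word) → IsRoot π w →
        (∃[ r ] RP π w r)
      × ((r : List Word) → RP π w r →
            Σ (Coalg.Roots destruct π r) (λ R →
                (word r ≡ w)
              × (tf π w ≅T Coalg.frag destruct R)
              × (st π w ≅F Coalg.sub destruct R))))
lemma2p16 π π-FFT =
  (λ r R → Roots⇒RP IsRoot-[] (st-[] (IsFFT.isTree π-FFT)) R) ,
  λ w w-root → RP-exists w-root , λ r → RP⇒Roots-[]
  where
  open RootPaths π π-FFT
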